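{- Let $t\ge1$ and let $G$ be a group of order $4t+2$. For every map $\phi:G\to\{\pm1\}$ with $\phi(1)=1$, the coboundary $\partial\phi\in Z^2(G,\langle-1\rangle)$, $\partial\phi(g,h)=\phi(g)^{ -1}\phi(h)^{ -1}\phi(gh)$, is not quasi-orthogonal.
   Context: A (normalized) cocycle is a map $\psi:G\times G\to\{\pm1\}$ with $\psi(g,h)\psi(gh,k)=\psi(g,hk)\psi(h,k)$ for all $g,h,k$ and $\psi(1,1)=1$; $Z^2(G,\langle-1\rangle)$ is the set of these. For an ordering $g_1=1,\dots,g_{4t+2}$ of $G$, $M_\psi=[\psi(g_i,g_j)]_{i,j}$. For an $n\times n$ $(\pm1)$-matrix $M=[m_{i,j}]$ with first row all $1$s, $RE(M)=\sum_{i=2}^n|\sum_{j=1}^n m_{i,j}|$. $\psi$ is quasi-orthogonal if $RE(M_\psi)=4t$. -}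

module Defs where

open import Level using (0ℓ)
open import Algebra.Bundles using (Group)
open import Data.Nat using (ℕ; suc; _*_; _+_)
open import Data.Fin using (Fin; zero; suc)
open import Data.Integer as ℤ using (ℤ; ∣_∣)
open import Data.Vec.Functional using (foldr)
open import Relation.Binary.PropositionalEquality using (_≡_)
open import Data.Product using (Σ; _×_)

data Sign : Set where
  plus minus : Sign

_·ₛ_ : Sign → Sign → Sign
plus  ·ₛ s = s
minus ·ₛ plus = minus
minus ·ₛ minus = plus

invₛ : Sign → Sign
invₛ s = s

toℤ : Sign → ℤ
toℤ plus  = ℤ.+ 1
toℤ minus = ℤ.- (ℤ.+ 1)

sumℤ : ∀ {n} → (Fin n → ℤ) → ℤ
sumℤ = foldr ℤ._+_ (ℤ.+ 0)

sumℕ : ∀ {n} → (Fin n → ℕ) → ℕ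
sumℕ = foldr _+_ 0

RE : ∀ {n} → (Fin n → Fin n → Sign) → ℕ
RE {ℕ.zero} M = 0
RE {suc n} M = sumℕ (λ (i : Fin n) → ∣ sumℤ (λ j → toℤ (M (suc i) j)) ∣)

module _ (G : Group 0ℓ 0ℓ) where
  open Group G renaming (Carrier to C)

  record Enumeration (n : ℕ) : Set where
    field
      enum       : Fin n → C
      enum-inj   : ∀ i j → enum i ≈ enum j → i ≡ j
      enum-surj  : ∀ g → Σ (Fin n) (λ i → enum i ≈ g)

  HasOrder : ℕ → Set
  HasOrder n = Enumeration n

  record SignMap : Set where
    field
      fun  : C → Sign
      resp : ∀ {g h} → g ≈ h → fun g ≡ fun h
  open SignMap public

  record Cochain2 : Set where
    field
      fun₂  : C → C → Sign
      resp₂ : ∀ {g g' h h'} → g ≈ g' → h ≈ h' → fun₂ g h ≡ fun₂ g' h'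
  open Cochain2 public

  IsCocycle : Cochain2 → Set
  IsCocycle ψ = (∀ g h k → (fun₂ ψ g h ·ₛ fun₂ ψ (g ∙ h) k) ≡ (fun₂ ψ g (h ∙ k) ·ₛ fun₂ ψ h k))
              × fun₂ ψ ε ε ≡ plus

  Mψ : ∀ {n} → Enumeration n → Cochain2 → Fin n → Fin n → Sign
  Mψ E ψ i j = fun₂ ψ (Enumeration.enum E i) (Enumeration.enum E j)

  -- ψ is quasi-orthogonal (for |G| = 4t+2): RE(M_ψ) = 4t, for the ordering E with g₁ = 1
  QuasiOrthogonal : (t : ℕ) → Enumeration (suc (suc (4 * t))) → Cochain2 → Set
  QuasiOrthogonal t E ψ = RE (Mψ E ψ) ≡ 4 * t

  ∂ : SignMap → Cochain2
  ∂ φ = record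
    { fun₂  = λ g h → (invₛ (fun φ g) ·ₛ invₛ (fun φ h)) ·ₛ fun φ (g ∙ h)
    ; resp₂ = λ {g} {g'} {h} {h'} p q → r g g' h h' p q }
    where
    open import Relation.Binary.PropositionalEquality using (cong₂)
    r : ∀ g g' h h' → g ≈ g' → h ≈ h' →
        ((invₛ (fun φ g) ·ₛ invₛ (fun φ h)) ·ₛ fun φ (g ∙ h))
        ≡ ((invₛ (fun φ g') ·ₛ invₛ (fun φ h')) ·ₛ fun φ (g' ∙ h'))
    r g g' h h' p q = cong₂ _·ₛ_ (cong₂ _·ₛ_ (resp φ p) (resp φ q)) (resp φ (∙-cong p q))

-- Regard a row of the matrix M_∂φ as a ±1-vector.  For the row of g
-- the product of its entries is
--     ∏_h φ(g)φ(h)φ(gh) = φ(g)ⁿ · ∏_h φ(h) · ∏_h φ(gh) = 1,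
-- because n is even and h ↦ gh permutes G.  A ±1-vector of length n with m
-- entries equal to -1 has product (-1)^m and sum n - 2m; if the sum were 0
-- then m = n/2 = 2t+1 would be odd, contradicting product 1.  Hence every
-- row has a nonzero sum, and RE(M_∂φ) ≥ n - 1 = 4t+1 > 4t.
module Submission where

open import Defs
open import Level using (0ℓ)
open import Algebra.Bundles using (Group; CommutativeMonoid)
open import Data.Nat using (ℕ; suc; zero; _*_; _≥_; _≤_; _+_; z≤n; s≤s)
import Data.Nat.Properties as ℕP
open import Data.Nat.Tactic.RingSolver using (solve-∀)
open import Data.Fin using (Fin; zero; suc)
open import Data.Fin.Permutation using (Permutation′; permutation)
open import Data.Integer as ℤ using (∣_∣) renaming (_+_ to _+ℤ_)
import Data.Integer.Properties as ℤP
open import Data.Product using (_×_; _,_; proj₁; proj₂)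
open import Data.Vec.Functional using (Vector)
open import Function using (_∘_)
open import Relation.Binary.PropositionalEquality hiding (resp)
open import Relation.Nullary using (¬_; contradiction)

·ₛ-assoc : ∀ a b c → (a ·ₛ b) ·ₛ c ≡ a ·ₛ (b ·ₛ c)
·ₛ-assoc plus  b     c     = refl
·ₛ-assoc minus plus  c     = refl
·ₛ-assoc minus minus plus  = refl
·ₛ-assoc minus minus minus = refl

·ₛ-comm : ∀ a b → a ·ₛ b ≡ b ·ₛ a
·ₛ-comm plus  plus  = refl
·ₛ-comm plus  minus = refl
·ₛ-comm minus plus  = refl
·ₛ-comm minus minus = refl

·ₛ-identityʳ : ∀ a → a ·ₛ plus ≡ a
·ₛ-identityʳ plus  = refl
·ₛ-identityʳ minus = refl

·ₛ-self : ∀ a → a ·ₛ a ≡ plus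
·ₛ-self plus  = refl
·ₛ-self minus = refl

-- {±1} under multiplication, packaged so that the library's theory of finite
-- sums over commutative monoids applies to products of signs.
sign-commutativeMonoid : CommutativeMonoid 0ℓ 0ℓ
sign-commutativeMonoid = record
  { Carrier = Sign ; _≈_ = _≡_ ; _∙_ = _·ₛ_ ; ε = plus
  ; isCommutativeMonoid = record
    { isMonoid = record
      { isSemigroup = record
        { isMagma = record { isEquivalence = isEquivalence ; ∙-cong = cong₂ _·ₛ_ }
        ; assoc = ·ₛ-assoc }
      ; identity = (λ _ → refl) , ·ₛ-identityʳ }
    ; comm = ·ₛ-comm } }

-- Finite products  prod v = v₀ ·ₛ … ·ₛ vₙ₋₁  and powers  k ×ₛ a = aᵏ  of signs.
open import Algebra.Properties.CommutativeMonoid.Sum sign-commutativeMonoid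
  using (∑-distrib-+; ∑-permute; sum-cong-≗; sum-replicate) renaming (sum to prod)
open import Algebra.Properties.Monoid.Mult (CommutativeMonoid.monoid sign-commutativeMonoid)
  using (×-homo-+) renaming (_×_ to _×ₛ_)
open import Algebra.Solver.CommutativeMonoid sign-commutativeMonoid using (solve; _⊕_; _⊜_)

power-even : ∀ k a → (k + k) ×ₛ a ≡ plus
power-even k a = trans (×-homo-+ a k k) (·ₛ-self (k ×ₛ a))

prod-const-even : ∀ {n} k a → n ≡ k + k → prod {n} (λ _ → a) ≡ plus
prod-const-even k a refl = trans (sum-replicate (k + k)) (power-even k a)

power-odd-minus : ∀ k → suc (k + k) ×ₛ minus ≡ minus
power-odd-minus k = cong (minus ·ₛ_) (power-even k minus)

-- The cocycle identity for ∂φ, with a,b,c = φ(g),φ(h),φ(k), x = φ(gh),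
-- y = φ(hk), z = φ(ghk): both sides reduce to a·b·c·z since x² = y² = 1.
coboundary-identity : ∀ a b c x y z →
  ((a ·ₛ b) ·ₛ x) ·ₛ ((x ·ₛ c) ·ₛ z) ≡ ((a ·ₛ y) ·ₛ z) ·ₛ ((b ·ₛ c) ·ₛ y)
coboundary-identity a b c x y z = begin
  ((a ·ₛ b) ·ₛ x) ·ₛ ((x ·ₛ c) ·ₛ z)   ≡⟨ regroup a b c x z ⟩
  (((a ·ₛ b) ·ₛ c) ·ₛ z) ·ₛ (x ·ₛ x)   ≡⟨ cong ((((a ·ₛ b) ·ₛ c) ·ₛ z) ·ₛ_) (trans (·ₛ-self x) (sym (·ₛ-self y))) ⟩
  (((a ·ₛ b) ·ₛ c) ·ₛ z) ·ₛ (y ·ₛ y)   ≡⟨ sym (regroup′ a b c y z) ⟩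
  ((a ·ₛ y) ·ₛ z) ·ₛ ((b ·ₛ c) ·ₛ y)   ∎
  where
  open ≡-Reasoning
  regroup : ∀ a b c x z → ((a ·ₛ b) ·ₛ x) ·ₛ ((x ·ₛ c) ·ₛ z) ≡ (((a ·ₛ b) ·ₛ c) ·ₛ z) ·ₛ (x ·ₛ x)
  regroup = solve 5 (λ a b c x z → ((a ⊕ b) ⊕ x) ⊕ ((x ⊕ c) ⊕ z) ⊜ (((a ⊕ b) ⊕ c) ⊕ z) ⊕ (x ⊕ x)) refl
  regroup′ : ∀ a b c y z → ((a ·ₛ y) ·ₛ z) ·ₛ ((b ·ₛ c) ·ₛ y) ≡ (((a ·ₛ b) ·ₛ c) ·ₛ z) ·ₛ (y ·ₛ y)
  regroup′ = solve 5 (λ a b c y z → ((a ⊕ y) ⊕ z) ⊕ ((b ⊕ c) ⊕ y) ⊜ (((a ⊕ b) ⊕ c) ⊕ z) ⊕ (y ⊕ y)) refl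

∂-isCocycle : (G : Group 0ℓ 0ℓ) (φ : SignMap G) → fun φ (Group.ε G) ≡ plus → IsCocycle G (∂ G φ)
∂-isCocycle G φ φε = cocycle-law , normalised
  where
  open Group G using (_∙_; ε; assoc; identityˡ)
  f = fun φ
  cocycle-law : ∀ g h k → (fun₂ (∂ G φ) g h ·ₛ fun₂ (∂ G φ) (g ∙ h) k)
                          ≡ (fun₂ (∂ G φ) g (h ∙ k) ·ₛ fun₂ (∂ G φ) h k)
  cocycle-law g h k =
    trans (cong (λ z → ((f g ·ₛ f h) ·ₛ f (g ∙ h)) ·ₛ ((f (g ∙ h) ·ₛ f k) ·ₛ z)) (resp φ (assoc g h k)))
          (coboundary-identity (f g) (f h) (f k) (f (g ∙ h)) (f (h ∙ k)) (f (g ∙ (h ∙ k))))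
  normalised : fun₂ (∂ G φ) ε ε ≡ plus
  normalised = trans (cong ((f ε ·ₛ f ε) ·ₛ_) (resp φ (identityˡ ε)))
                     (trans (cong (_·ₛ f ε) (·ₛ-self (f ε))) φε)

module RowProduct (G : Group 0ℓ 0ℓ) {n : ℕ} (E : Enumeration G n) where
  open Group G using (_≈_; _∙_; _⁻¹; assoc; identityˡ; inverseˡ; inverseʳ; ∙-congˡ; ∙-congʳ)
    renaming (Carrier to C; trans to trans≈; sym to sym≈)
  open Enumeration E

  index : C → Fin n
  index g = proj₁ (enum-surj g)

  enum-index : ∀ g → enum (index g) ≈ g
  enum-index g = proj₂ (enum-surj g)

  translation : C → Permutation′ n
  translation g = permutation (λ j → index (g ∙ enum j)) (λ j → index (g ⁻¹ ∙ enum j))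
                              (cancel g (g ⁻¹) (inverseʳ g)) (cancel (g ⁻¹) g (inverseˡ g))
    where
    cancel : ∀ u v → u ∙ v ≈ Group.ε G → ∀ j → index (u ∙ enum (index (v ∙ enum j))) ≡ j
    cancel u v uv≈1 j = enum-inj _ _
      (trans≈ (enum-index _) (trans≈ (∙-congˡ (enum-index _))
        (trans≈ (sym≈ (assoc u v (enum j))) (trans≈ (∙-congʳ uv≈1) (identityˡ (enum j))))))

  prod-translate : (φ : SignMap G) (g : C) →
                   prod (λ j → fun φ (g ∙ enum j)) ≡ prod (λ j → fun φ (enum j))
  prod-translate φ g = sym (trans (∑-permute {n} {n} (fun φ ∘ enum) (translation g))
                                  (sum-cong-≗ {n} (λ j → resp φ (enum-index (g ∙ enum j)))))

  ∂-row-product : (k : ℕ) → n ≡ k + k → (φ : SignMap G) (g : C) →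
                  prod (λ j → fun₂ (∂ G φ) g (enum j)) ≡ plus
  ∂-row-product k n≡k+k φ g = begin
    prod (λ j → (a ·ₛ b j) ·ₛ c j)       ≡⟨ sum-cong-≗ {n} (λ j → ·ₛ-assoc a (b j) (c j)) ⟩
    prod (λ j → a ·ₛ (b j ·ₛ c j))       ≡⟨ ∑-distrib-+ {n} (λ _ → a) (λ j → b j ·ₛ c j) ⟩
    prod {n} (λ _ → a) ·ₛ prod (λ j → b j ·ₛ c j)
      ≡⟨ cong₂ _·ₛ_ (prod-const-even k a n≡k+k) (∑-distrib-+ {n} b c) ⟩
    prod b ·ₛ prod c                     ≡⟨ cong (prod b ·ₛ_) (prod-translate φ g) ⟩
    prod b ·ₛ prod b                     ≡⟨ ·ₛ-self (prod b) ⟩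
    plus                                 ∎
    where
    open ≡-Reasoning
    a : Sign
    a = fun φ g
    b c : Vector Sign n
    b j = fun φ (enum j)
    c j = fun φ (g ∙ enum j)

isMinus : Sign → ℕ
isMinus plus  = 0
isMinus minus = 1

#minus : ∀ {n} → Vector Sign n → ℕ
#minus v = sumℕ (isMinus ∘ v)

prod-#minus : ∀ {n} (v : Vector Sign n) → prod v ≡ #minus v ×ₛ minus
prod-#minus {zero}  v = refl
prod-#minus {suc n} v = begin
  v zero ·ₛ prod (v ∘ suc)                                ≡⟨ cong₂ _·ₛ_ (entry (v zero)) (prod-#minus (v ∘ suc)) ⟩
  (isMinus (v zero) ×ₛ minus) ·ₛ (#minus (v ∘ suc) ×ₛ minus) ≡⟨ sym (×-homo-+ minus (isMinus (v zero)) _) ⟩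
  #minus v ×ₛ minus                                       ∎
  where
  open ≡-Reasoning
  entry : ∀ a → a ≡ isMinus a ×ₛ minus
  entry plus  = refl
  entry minus = refl

sum-#minus : ∀ {n} (v : Vector Sign n) → sumℤ (toℤ ∘ v) +ℤ ℤ.+ (#minus v + #minus v) ≡ ℤ.+ n
sum-#minus {zero}  v = refl
sum-#minus {suc n} v = begin
  (toℤ a +ℤ S) +ℤ ℤ.+ ((i + m) + (i + m))      ≡⟨ cong (λ x → (toℤ a +ℤ S) +ℤ ℤ.+ x) (ℕ-interchange i m i m) ⟩
  (toℤ a +ℤ S) +ℤ ℤ.+ ((i + i) + (m + m))      ≡⟨ cong ((toℤ a +ℤ S) +ℤ_) (ℤP.pos-+ (i + i) (m + m)) ⟩
  (toℤ a +ℤ S) +ℤ (ℤ.+ (i + i) +ℤ ℤ.+ (m + m)) ≡⟨ ℤ-interchange (toℤ a) S (ℤ.+ (i + i)) (ℤ.+ (m + m)) ⟩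
  (toℤ a +ℤ ℤ.+ (i + i)) +ℤ (S +ℤ ℤ.+ (m + m)) ≡⟨ cong₂ _+ℤ_ (entry a) (sum-#minus (v ∘ suc)) ⟩
  ℤ.+ suc n                                       ∎
  where
  open ≡-Reasoning
  open import Algebra.Properties.CommutativeSemigroup ℕP.+-commutativeSemigroup
    using () renaming (interchange to ℕ-interchange)
  open import Algebra.Properties.CommutativeSemigroup ℤP.+-commutativeSemigroup
    using () renaming (interchange to ℤ-interchange)
  a = v zero
  i = isMinus a
  S = sumℤ (toℤ ∘ v ∘ suc)
  m = #minus (v ∘ suc)
  entry : ∀ a → toℤ a +ℤ ℤ.+ (isMinus a + isMinus a) ≡ ℤ.+ 1
  entry plus  = refl
  entry minus = refl

-- A ±1-vector of length ≡ 2 (mod 4) with product +1 has nonzero sum: a zero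
-- sum would force an odd number 2k+1 of minus signs.
nonzero-sum : ∀ {n} (k : ℕ) → n ≡ suc (k + k) + suc (k + k) →
              (v : Vector Sign n) → prod v ≡ plus → 1 ≤ ∣ sumℤ (toℤ ∘ v) ∣
nonzero-sum {n} k n≡ v prod≡plus with ∣ sumℤ (toℤ ∘ v) ∣ in abs≡0
... | suc _ = s≤s z≤n
... | zero  = contradiction (trans (sym prod≡plus) (trans (prod-#minus v) minus-power)) λ ()
  where
  m = #minus v
  m+m≡n : m + m ≡ n
  m+m≡n = ℤP.+-injective
    (trans (cong (_+ℤ ℤ.+ (m + m)) (sym (ℤP.∣i∣≡0⇒i≡0 {i = sumℤ (toℤ ∘ v)} abs≡0))) (sum-#minus v))
  m≡2k+1 : m ≡ suc (k + k)
  m≡2k+1 = ℕP.*-cancelˡ-≡ m (suc (k + k)) 2 (begin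
    2 * m                                     ≡⟨ cong (m +_) (ℕP.+-identityʳ m) ⟩
    m + m                                     ≡⟨ trans m+m≡n n≡ ⟩
    suc (k + k) + suc (k + k)                 ≡⟨ cong (suc (k + k) +_) (sym (ℕP.+-identityʳ _)) ⟩
    2 * suc (k + k)                           ∎)
    where open ≡-Reasoning
  minus-power : m ×ₛ minus ≡ minus
  minus-power = trans (cong (_×ₛ minus) m≡2k+1) (power-odd-minus k)

sumℕ-positive : ∀ {n} (f : Vector ℕ n) → (∀ i → 1 ≤ f i) → n ≤ sumℕ f
sumℕ-positive {zero}  f pos = z≤n
sumℕ-positive {suc n} f pos = ℕP.+-mono-≤ (pos zero) (sumℕ-positive (f ∘ suc) (pos ∘ suc))

RE-lower-bound : ∀ {n} (M : Fin (suc n) → Fin (suc n) → Sign) →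
                 (∀ i → 1 ≤ ∣ sumℤ (toℤ ∘ M (suc i)) ∣) → n ≤ RE M
RE-lower-bound M rows = sumℕ-positive _ rows

four-t-plus-two : ∀ t → suc (suc (4 * t)) ≡ suc (t + t) + suc (t + t)
four-t-plus-two = solve-∀

proposition2 : (t : ℕ) → t ≥ 1 → (G : Group 0ℓ 0ℓ)
    → (E : Enumeration G (suc (suc (4 * t))))
    → Group._≈_ G (Enumeration.enum E zero) (Group.ε G)
    → (φ : SignMap G) → SignMap.fun φ (Group.ε G) ≡ plus
    → IsCocycle G (∂ G φ) × ¬ QuasiOrthogonal G t E (∂ G φ)
proposition2 t _ G E _ φ φε = ∂-isCocycle G φ φε , not-quasi-orthogonal
  where
  open RowProduct G E using (∂-row-product)
  row-product : ∀ i → prod (Mψ G E (∂ G φ) i) ≡ plus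
  row-product i = ∂-row-product (suc (t + t)) (four-t-plus-two t) φ _
  RE-bound : suc (4 * t) ≤ RE (Mψ G E (∂ G φ))
  RE-bound = RE-lower-bound (Mψ G E (∂ G φ))
    (λ i → nonzero-sum t (four-t-plus-two t) (Mψ G E (∂ G φ) (suc i)) (row-product (suc i)))
  not-quasi-orthogonal : ¬ QuasiOrthogonal G t E (∂ G φ)
  not-quasi-orthogonal qo = ℕP.<-irrefl (sym qo) RE-bound
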